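{- Let $\Lambda=(\mathcal{L},\mathfrak{M},\models)$ be a satisfaction system in which $\mathrm{FR}(\Lambda)$ is finite. Then $\Lambda$ is eviction-compatible if and only if $\emptyset\in\mathrm{FR}(\Lambda)$, and $\Lambda$ is reception-compatible if and only if $\mathfrak{M}\in\mathrm{FR}(\Lambda)$.
   Context: A satisfaction system is a triple $\Lambda=(\mathcal{L},\mathfrak{M},\models)$ where $\mathcal{L}$ is a set of formulae, $\mathfrak{M}$ a set of models, and $\models$ a relation between models and sets of formulae $B\subseteq\mathcal{L}$. $\mathrm{Mod}(B)=\{m\in\mathfrak{M}\mid m\models B\}$. $\mathrm{FR}(\Lambda)=\{X\subseteq\mathfrak{M}\mid X=\mathrm{Mod}(B)$ for some finite $B\subseteq\mathcal{L}\}$. For $\mathbb{M}\subseteq\mathfrak{M}$: $\mathrm{FRsubs}(\mathbb{M},\Lambda)=\{X\in\mathrm{FR}(\Lambda)\mid X\subseteq\mathbb{M}$ and no $Y\in\mathrm{FR}(\Lambda)$ has $X\subsetneq Y\subseteq\mathbb{M}\}$ and $\mathrm{FRsups}(\mathbb{M},\Lambda)=\{X\in\mathrm{FR}(\Lambda)\mid\mathbb{M}\subseteq X$ and no $Y\in\mathrm{FR}(\Lambda)$ has $\mathbb{M}\subseteq Y\subsetneq X\}$. $\Lambda$ is eviction-compatible if $\mathrm{FRsubs}(\mathrm{Mod}(B)\setminus\mathbb{M},\Lambda)\neq\emptyset$ for all finite $B\subseteq\mathcal{L}$ and all $\mathbb{M}\subseteq\mathfrak{M}$; it is reception-compatible if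 $\mathrm{FRsups}(\mathrm{Mod}(B)\cup\mathbb{M},\Lambda)\neq\emptyset$ for all finite $B\subseteq\mathcal{L}$ and all $\mathbb{M}\subseteq\mathfrak{M}$. -}

module Defs where

open import Level using (Level; 0ℓ) renaming (suc to lsuc)
open import Data.Product using (Σ; ∃; _×_; _,_)
open import Data.List using (List)
open import Data.List.Membership.Propositional using () renaming (_∈_ to _∈ₗ_)
open import Data.List.Relation.Unary.Any using (Any)
open import Data.List.Relation.Unary.All using (All)
open import Relation.Nullary using (¬_)
open import Relation.Unary using (Pred; _⊆_; _⊂_; _≐_; _∪_; _∖_)

record SatSystem : Set₂ where
  field
    Formula : Set
    Model   : Set
    _⊨_     : Model → Pred Formula 0ℓ → Set

module _ (Λ : SatSystem) where
  open SatSystem Λ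

  FiniteSet : Pred Formula 0ℓ → Set
  FiniteSet B = Σ (List Formula) λ l → B ≐ (λ φ → φ ∈ₗ l)

  Mod : Pred Formula 0ℓ → Pred Model 0ℓ
  Mod B = λ m → m ⊨ B

  IsFR : Pred Model 0ℓ → Set₁
  IsFR X = Σ (Pred Formula 0ℓ) λ B → FiniteSet B × (X ≐ Mod B)

  -- FR(Λ) is finite: there is a finite list of sets of models, all in
  -- FR(Λ), such that every element of FR(Λ) equals one of them
  FRFinite : Set₁
  FRFinite = Σ (List (Pred Model 0ℓ)) λ Xs →
               All IsFR Xs × (∀ X → IsFR X → Any (λ Y → X ≐ Y) Xs)

  InFRsubs : Pred Model 0ℓ → Pred Model 0ℓ → Set₁
  InFRsubs 𝕄 X = IsFR X × X ⊆ 𝕄 ×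
    ¬ (Σ (Pred Model 0ℓ) λ Y → IsFR Y × X ⊂ Y × Y ⊆ 𝕄)

  InFRsups : Pred Model 0ℓ → Pred Model 0ℓ → Set₁
  InFRsups 𝕄 X = IsFR X × 𝕄 ⊆ X ×
    ¬ (Σ (Pred Model 0ℓ) λ Y → IsFR Y × 𝕄 ⊆ Y × Y ⊂ X)

  EvictionCompatible : Set₁
  EvictionCompatible = ∀ (B : Pred Formula 0ℓ) → FiniteSet B →
    ∀ (𝕄 : Pred Model 0ℓ) → Σ (Pred Model 0ℓ) (InFRsubs (Mod B ∖ 𝕄))

  ReceptionCompatible : Set₁
  ReceptionCompatible = ∀ (B : Pred Formula 0ℓ) → FiniteSet B →
    ∀ (𝕄 : Pred Model 0ℓ) → Σ (Pred Model 0ℓ) (InFRsups (Mod B ∪ 𝕄))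

{-# OPTIONS --safe #-}
-- With only finitely many finitely representable sets up to equality, every
-- nonempty family of them contains a ⊆-maximal and a ⊆-minimal member: moving
-- strictly up in a preorder strictly decreases the number of listed elements
-- above, so classically one reaches a maximal element.  Hence if ∅ ∈ FR(Λ)
-- then every Mod(B) ∖ 𝕄 has a maximal finitely representable subset, and if
-- 𝔐 ∈ FR(Λ) then every Mod(B) ∪ 𝕄 has a minimal finitely representable
-- superset.  Conversely, instantiating B := ∅ and 𝕄 := 𝔐 forces the subset
-- to be ∅ and the superset to be 𝔐.
module Submission where

open import Defs
open import Level using (Level; 0ℓ)
open import Data.Product using (_×_; ∃; _,_; proj₁; proj₂; swap)
open import Data.Sum using (inj₂)
open import Data.Empty using (⊥-elim)
open import Data.Nat using (ℕ; suc; _≤_; _<_; z≤n; s≤s)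
open import Data.Nat.Properties using (m≤n⇒m≤1+n; m<n⇒m<1+n)
open import Data.Nat.Induction using (<-wellFounded)
open import Data.List using (List; []; _∷_)
open import Data.List.Relation.Unary.Any as Any using (Any; here; there)
open import Function.Base using (_on_; _∘_; flip)
open import Function.Bundles using (_⇔_; mk⇔)
open import Induction.WellFounded using (Acc; acc)
open import Relation.Binary.Core using (Rel)
open import Relation.Binary.Definitions using (Transitive)
import Relation.Binary.Construct.On as On
open import Relation.Nullary using (¬_; yes; no)
open import Relation.Unary using (∅; U; Pred; _⊆_; _∪_; _∖_)
open import Relation.Unary.Properties using (⊆-trans)
open import Axiom.ExcludedMiddle using (ExcludedMiddle)

module ClassicalMaximal
  {a ℓ : Level} (em : ∀ {p} → ExcludedMiddle p)
  {S : Set a} (_≲_ : Rel S ℓ) (≲-trans : Transitive _≲_) where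

  _⊏_ : Rel S ℓ
  X ⊏ Y = X ≲ Y × ¬ Y ≲ X

  #above : S → List S → ℕ
  #above X [] = 0
  #above X (Y ∷ Ys) with em {P = X ≲ Y}
  ... | yes _ = suc (#above X Ys)
  ... | no  _ = #above X Ys

  #above-antitone : ∀ {X Z} → X ≲ Z → ∀ Ys → #above Z Ys ≤ #above X Ys
  #above-antitone X≲Z [] = z≤n
  #above-antitone {X} {Z} X≲Z (Y ∷ Ys) with em {P = X ≲ Y} | em {P = Z ≲ Y}
  ... | yes _   | yes _   = s≤s (#above-antitone X≲Z Ys)
  ... | yes _   | no  _   = m≤n⇒m≤1+n (#above-antitone X≲Z Ys)
  ... | no  X≴Y | yes Z≲Y = ⊥-elim (X≴Y (≲-trans X≲Z Z≲Y))
  ... | no  _   | no  _   = #above-antitone X≲Z Ys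

  -- X itself is counted for X (through its listed representative) but not for Z.
  #above-strict : ∀ {X Z} → X ⊏ Z → ∀ {Ys} → Any (λ Y → X ≲ Y × Y ≲ X) Ys →
                  #above Z Ys < #above X Ys
  #above-strict {X} {Z} (X≲Z , Z≴X) {Y ∷ Ys} (here (X≲Y , Y≲X))
    with em {P = X ≲ Y} | em {P = Z ≲ Y}
  ... | _       | yes Z≲Y = ⊥-elim (Z≴X (≲-trans Z≲Y Y≲X))
  ... | yes _   | no  _   = s≤s (#above-antitone X≲Z Ys)
  ... | no  X≴Y | no  _   = ⊥-elim (X≴Y X≲Y)
  #above-strict {X} {Z} X⊏Z@(X≲Z , _) {Y ∷ Ys} (there rep)
    with em {P = X ≲ Y} | em {P = Z ≲ Y}
  ... | yes _   | yes _   = s≤s (#above-strict X⊏Z rep)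
  ... | yes _   | no  _   = m<n⇒m<1+n (#above-strict X⊏Z rep)
  ... | no  X≴Y | yes Z≲Y = ⊥-elim (X≴Y (≲-trans X≲Z Z≲Y))
  ... | no  _   | no  _   = #above-strict X⊏Z rep

  module _ {g : Level} (Good : Pred S g) (Xs : List S)
           (listed : ∀ {X} → Good X → Any (λ Y → X ≲ Y × Y ≲ X) Xs) where

    Maximal : Pred S _
    Maximal X = Good X × ¬ (∃ λ Y → Good Y × X ⊏ Y)

    maximal-exists : ∀ {X} → Good X → ∃ Maximal
    maximal-exists {X} = go (On.wellFounded (λ X → #above X Xs) <-wellFounded X)
      where
      go : ∀ {X} → Acc (_<_ on λ X → #above X Xs) X → Good X → ∃ Maximal
      go {X} (acc rec) good-X with em {P = ∃ λ Y → Good Y × X ⊏ Y}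
      ... | no  X-max              = X , good-X , X-max
      ... | yes (Y , good-Y , X⊏Y) = go (rec (#above-strict X⊏Y (listed good-X))) good-Y

module _ (em : ∀ {ℓ : Level} → ExcludedMiddle ℓ) (Λ : SatSystem) (fin : FRFinite Λ) where
  open SatSystem Λ

  private
    Models : Set₁
    Models = Pred Model 0ℓ

    FRs : List Models
    FRs = proj₁ fin

    FR-listed : ∀ {X} → IsFR Λ X → Any (λ Y → X ⊆ Y × Y ⊆ X) FRs
    FR-listed {X} = proj₂ (proj₂ fin) X

    ∅-finite : FiniteSet Λ ∅
    ∅-finite = [] , (λ ()) , (λ ())

    module ⊆-Maximal = ClassicalMaximal em {S = Models} _⊆_ ⊆-trans
    module ⊇-Maximal = ClassicalMaximal em {S = Models} (λ X Y → Y ⊆ X) (flip ⊆-trans)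

  eviction⇒∅∈FR : EvictionCompatible Λ → IsFR Λ ∅
  eviction⇒∅∈FR ev with ev ∅ ∅-finite U
  ... | X , (B , B-finite , _ , ModB⊆X) , X⊆∅ , _ =
    B , B-finite , (λ ()) , λ m⊨B → proj₂ (X⊆∅ (ModB⊆X m⊨B)) _

  ∅∈FR⇒eviction : IsFR Λ ∅ → EvictionCompatible Λ
  ∅∈FR⇒eviction ∅∈FR B _ 𝕄
    with ⊆-Maximal.maximal-exists (λ X → IsFR Λ X × X ⊆ Mod Λ B ∖ 𝕄) FRs
           (FR-listed ∘ proj₁) (∅∈FR , λ ())
  ... | X , (X∈FR , X⊆) , X-max =
    X , X∈FR , X⊆ , λ (Y , Y∈FR , X⊂Y , Y⊆) → X-max (Y , (Y∈FR , Y⊆) , X⊂Y)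

  reception⇒U∈FR : ReceptionCompatible Λ → IsFR Λ U
  reception⇒U∈FR rc with rc ∅ ∅-finite U
  ... | X , (B , B-finite , X⊆ModB , _) , U⊆X , _ =
    B , B-finite , (λ _ → X⊆ModB (U⊆X (inj₂ _))) , _

  U∈FR⇒reception : IsFR Λ U → ReceptionCompatible Λ
  U∈FR⇒reception U∈FR B _ 𝕄
    with ⊇-Maximal.maximal-exists (λ X → IsFR Λ X × Mod Λ B ∪ 𝕄 ⊆ X) FRs
           (Any.map swap ∘ FR-listed ∘ proj₁) (U∈FR , _)
  ... | X , (X∈FR , ⊆X) , X-min =
    X , X∈FR , ⊆X , λ (Y , Y∈FR , ⊆Y , Y⊂X) → X-min (Y , (Y∈FR , ⊆Y) , Y⊂X)

corollary1 : (∀ {ℓ : Level} → ExcludedMiddle ℓ) →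
    (Λ : SatSystem) → FRFinite Λ →
      (EvictionCompatible Λ ⇔ IsFR Λ ∅) × (ReceptionCompatible Λ ⇔ IsFR Λ U)
corollary1 em Λ fin =
  mk⇔ (eviction⇒∅∈FR em Λ fin) (∅∈FR⇒eviction em Λ fin) ,
  mk⇔ (reception⇒U∈FR em Λ fin) (U∈FR⇒reception em Λ fin)
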